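{- Let $X\subseteq 2^\omega$ be a perfect set, $n<\omega$, $s_0\in 2^n$, and let $A\subseteq X\restriction s_0$ be a perfect set. Then $Y=A\cup\bigcup_{u\in 2^n,\,u\ne s_0}X\restriction u$ is perfect, $Y\trianglelefteq_n X$, and $Y\restriction s_0=A$.
   Context: For a nonempty perfect set $X\subseteq 2^\omega$, let $s$ be the longest finite binary string that is an initial segment of every $x\in X$, and let $n=$ length of $s$; the simple splitting of $X$ consists of $X\restriction i=\{x\in X: x(n)=i\}$ for $i=0,1$ (both are perfect and partition $X$). Iterating: $X\restriction\Lambda=X$ for the empty string $\Lambda$, and for a string $s=(s(0),\dots,s(n-1))\in 2^n$, $X\restriction s=(\cdots((X\restriction s(0))\restriction s(1))\cdots)\restriction s(n-1)$. For perfect $X,Y\subseteq 2^\omega$ and $n<\omega$, $Y\trianglelefteq_n X$ means $Y\restriction s\subseteq X\restriction s$ for all $s\in 2^n$. -}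

module Defs where

open import Data.Nat using (ℕ; _<_)
open import Level using (Lift)
open import Data.Bool using (Bool)
open import Data.Vec using (Vec; []; _∷_)
open import Data.Product using (Σ; _×_; ∃)
open import Data.Sum using (_⊎_)
open import Relation.Binary.PropositionalEquality using (_≡_; _≢_)

Cantor : Set
Cantor = ℕ → Bool

SubSet : Set₁
SubSet = Cantor → Set

_⊆_ : SubSet → SubSet → Set
X ⊆ Y = ∀ x → X x → Y x

_≐_ : SubSet → SubSet → Set
X ≐ Y = X ⊆ Y × Y ⊆ X

AgreeBelow : ℕ → Cantor → Cantor → Set
AgreeBelow k x y = ∀ i → i < k → x i ≡ y i

Differ : Cantor → Cantor → Set
Differ x y = ∃ λ j → x j ≢ y j

Closed : SubSet → Set
Closed X = ∀ x → (∀ k → ∃ λ y → X y × AgreeBelow k x y) → X x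

NoIsolated : SubSet → Set
NoIsolated X = ∀ x → X x → ∀ k → ∃ λ y → X y × AgreeBelow k x y × Differ x y

Perfect : SubSet → Set
Perfect X = (∃ λ x → X x) × Closed X × NoIsolated X

-- IsSplit X i Z : Z = X ↾ i (simple splitting).  m is the length of the longest
-- common initial segment of all elements of X: all elements agree below m,
-- and two elements of X differ at m.
IsSplit : SubSet → Bool → SubSet → Set
IsSplit X i Z = Σ ℕ λ m →
    (∀ x y → X x → X y → AgreeBelow m x y)
  × (∃ λ x → ∃ λ y → X x × X y × x m ≢ y m)
  × (Z ≐ (λ x → X x × x m ≡ i))

-- IsRestr X s Z : Z = X ↾ s, where X ↾ (b ∷ s) = (X ↾ b) ↾ s
IsRestr : ∀ {n} → SubSet → Vec Bool n → SubSet → Set₁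
IsRestr X [] Z = Lift _ (Z ≐ X)
IsRestr X (b ∷ s) Z = Σ SubSet λ W → IsSplit X b W × IsRestr W s Z

-- Y ⊴ₙ X : Y ↾ s ⊆ X ↾ s for all s ∈ 2^n
Tri : ℕ → SubSet → SubSet → Set₁
Tri n Y X = ∀ (s : Vec Bool n) (Ys Xs : SubSet) →
  IsRestr Y s Ys → IsRestr X s Xs → Ys ⊆ Xs

Glue : ∀ {n} → SubSet → Vec Bool n → (Vec Bool n → SubSet) → SubSet
Glue {n} A s₀ Z x = A x ⊎ Σ (Vec Bool n) λ u → u ≢ s₀ × Z u x

module Submission where

-- Write X ↾ u = Z u.  The pieces Z u (u ∈ 2ⁿ) are pairwise disjoint, cover X, and
-- are open in X with a uniform radius (membership in Z u is decided by finitely many coordinates).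
-- Perfectness of Y = Glue A s₀ Z then follows pointwise: near a point of A the set Y coincides
-- with A (the other pieces are far away), near a point of Z u, u ≠ s₀, it coincides with X.
-- The restriction statements go by induction on s₀ = b ∷ t.  If X splits at level m, then
-- Y ⊆ X has points on both sides of m (one in A, one in Z (not b ∷ t)), so Y splits at the same
-- level; the half Y ↾ b is again a glued set, Glue A t (Z ∘ (b ∷_)), built over X ↾ b, and the
-- other half Y ↾ c equals X ↾ c outright.

open import Defs
open import Data.Nat using (ℕ; zero; suc; _≤_; _⊔_)
open import Data.Nat.Properties using (<-cmp; m≤m⊔n; m≤n⊔m; <-≤-trans; n<1+n)
open import Data.Bool using (Bool; false; not)
open import Data.Bool.Properties using (not-¬; ¬-not; not-injective) renaming (_≟_ to _≟B_)
open import Data.Vec using (Vec; []; _∷_; replicate)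
open import Data.Vec.Properties using (∷-injective; ≡-dec)
open import Data.Product using (Σ; _×_; ∃; _,_; proj₁; proj₂)
open import Data.Sum using (inj₁; inj₂)
open import Data.Empty using (⊥; ⊥-elim)
open import Level using (lift; lower)
open import Relation.Nullary using (yes; no)
open import Relation.Binary.PropositionalEquality using (_≡_; _≢_; refl; sym; trans; cong)
open import Relation.Binary using (tri<; tri≈; tri>)

≐-refl : ∀ {X} → X ≐ X
≐-refl = (λ _ p → p) , (λ _ p → p)

≐-sym : ∀ {X Y} → X ≐ Y → Y ≐ X
≐-sym (f , g) = g , f

≐-trans : ∀ {X Y W} → X ≐ Y → Y ≐ W → X ≐ W
≐-trans (f , g) (h , k) = (λ x p → h x (f x p)) , (λ x p → g x (k x p))

agree-mono : ∀ {k k' x y} → k ≤ k' → AgreeBelow k' x y → AgreeBelow k x y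
agree-mono k≤k' ag i i<k = ag i (<-≤-trans i<k k≤k')

level : ∀ {X b W} → IsSplit X b W → ℕ
level = proj₁

-- The splitting level depends on X only: below it all points of X agree, at it two differ.
level-unique : ∀ {X b c W W'} (sp : IsSplit X b W) (sp' : IsSplit X c W') →
  level sp ≡ level sp'
level-unique (m , agree , (x , y , Xx , Xy , x≢y) , _) (m' , agree' , (x' , y' , Xx' , Xy' , x'≢y') , _)
  with <-cmp m m'
... | tri< m<m' _ _ = ⊥-elim (x≢y (agree' x y Xx Xy m m<m'))
... | tri≈ _ m≡m' _ = m≡m'
... | tri> _ _ m'<m = ⊥-elim (x'≢y' (agree x' y' Xx' Xy' m' m'<m))

split-sub : ∀ {X c W} → IsSplit X c W → W ⊆ X
split-sub (_ , _ , _ , W⊆ , _) x w = proj₁ (W⊆ x w)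

split-value : ∀ {X b c W W' x} (sp : IsSplit X c W) (sp' : IsSplit X b W') →
  W x → x (level sp') ≡ c
split-value {x = x} sp@(_ , _ , _ , W⊆ , _) sp' w =
  trans (cong x (sym (level-unique sp sp'))) (proj₂ (W⊆ x w))

split-member : ∀ {X b c W W' x} (sp : IsSplit X c W) (sp' : IsSplit X b W') →
  X x → x (level sp') ≡ c → W x
split-member {x = x} sp@(_ , _ , _ , _ , ⊆W) sp' Xx xc =
  ⊆W x (Xx , trans (cong x (level-unique sp sp')) xc)

split-unique : ∀ {X b W W'} → IsSplit X b W → IsSplit X b W' → W ≐ W'
split-unique sp sp' =
  (λ x w → split-member sp' sp (split-sub sp x w) (split-value sp sp w)) ,
  (λ x w → split-member sp sp' (split-sub sp' x w) (split-value sp' sp' w))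

split-resp : ∀ {X X' W W' b} → X ≐ X' → W ≐ W' → IsSplit X b W → IsSplit X' b W'
split-resp (X⊆ , ⊆X) (W⊆ , ⊆W) (m , agree , (x , y , Xx , Xy , x≢y) , W⊆X , ⊆W₀) =
  m , (λ a c Xa Xc → agree a c (⊆X a Xa) (⊆X c Xc)) , (x , y , X⊆ x Xx , X⊆ y Xy , x≢y) ,
  (λ a w → X⊆ a (proj₁ (W⊆X a (⊆W a w))) , proj₂ (W⊆X a (⊆W a w))) ,
  (λ a p → W⊆ a (⊆W₀ a (⊆X a (proj₁ p) , proj₂ p)))

-- Both halves of a splitting are nonempty: one of the two witnesses lands in X ↾ b.
split-nonempty : ∀ {X b W} → IsSplit X b W → ∃ W
split-nonempty {b = b} (m , _ , (x , y , Xx , Xy , x≢y) , _ , ⊆W) with x m ≟B b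
... | yes xb = x , ⊆W x (Xx , xb)
... | no x≢b = y , ⊆W y (Xy , not-injective (trans (sym (¬-not x≢y)) (¬-not x≢b)))

split-subset : ∀ {X Y b W} c (sp : IsSplit X b W) → Y ⊆ X →
  (∃ λ x → ∃ λ y → Y x × Y y × x (level sp) ≢ y (level sp)) →
  IsSplit Y c (λ x → Y x × x (level sp) ≡ c)
split-subset c (m , agree , _) Y⊆X differ =
  m , (λ x y Yx Yy → agree x y (Y⊆X x Yx) (Y⊆X y Yy)) , differ , ≐-refl

restr-resp : ∀ {n X X' Z Z'} {s : Vec Bool n} → X ≐ X' → Z ≐ Z' → IsRestr X s Z → IsRestr X' s Z'
restr-resp {s = []} X≐X' Z≐Z' (lift Z≐X) = lift (≐-trans (≐-sym Z≐Z') (≐-trans Z≐X X≐X'))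
restr-resp {s = b ∷ s} X≐X' Z≐Z' (W , sp , r) = W , split-resp X≐X' ≐-refl sp , restr-resp ≐-refl Z≐Z' r

restr-unique : ∀ {n X Z Z'} {s : Vec Bool n} → IsRestr X s Z → IsRestr X s Z' → Z ≐ Z'
restr-unique {s = []} (lift Z≐X) (lift Z'≐X) = ≐-trans Z≐X (≐-sym Z'≐X)
restr-unique {s = b ∷ s} (_ , sp , r) (_ , sp' , r') =
  restr-unique r (restr-resp (split-unique sp' sp) ≐-refl r')

restr-sub : ∀ {n X Z} {s : Vec Bool n} → IsRestr X s Z → Z ⊆ X
restr-sub {s = []} (lift Z≐X) = proj₁ Z≐X
restr-sub {s = b ∷ s} (_ , sp , r) x z = split-sub sp x (restr-sub r x z)

restr-nonempty : ∀ {n X Z} {s : Vec Bool n} → IsRestr X s Z → ∃ X → ∃ Z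
restr-nonempty {s = []} (lift Z≐X) (x , Xx) = x , proj₂ Z≐X x Xx
restr-nonempty {s = b ∷ s} (_ , sp , r) _ = restr-nonempty r (split-nonempty sp)

head-split : ∀ {n X} (Z : Vec Bool (suc n) → SubSet) → (∀ u → IsRestr X u (Z u)) → (c : Bool) →
  Σ SubSet λ W → IsSplit X c W × (∀ v → IsRestr W v (Z (c ∷ v)))
head-split {n} Z H c with H (c ∷ replicate n false)
... | W , sp , _ = W , sp , λ v → restr-resp (split-unique (proj₁ (proj₂ (H (c ∷ v)))) sp) ≐-refl
                                               (proj₂ (proj₂ (H (c ∷ v))))

restr-head-value : ∀ {n X b c W Zc x} {v : Vec Bool n} (sp : IsSplit X b W) →
  IsRestr X (c ∷ v) Zc → Zc x → x (level sp) ≡ c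
restr-head-value sp (_ , sp' , r) z = split-value sp' sp (restr-sub r _ z)

-- The pieces X ↾ u, u ∈ 2ⁿ, cover X: follow the bits of x at the successive splitting levels.
restr-cover : ∀ n {X} {Z : Vec Bool n → SubSet} → (∀ u → IsRestr X u (Z u)) →
  ∀ x → X x → Σ (Vec Bool n) λ u → Z u x
restr-cover zero H x Xx = [] , proj₂ (lower (H [])) x Xx
restr-cover (suc n) {Z = Z} H x Xx with head-split Z H false
... | _ , sp₀ , _ with head-split Z H (x (level sp₀))
... | _ , sp , HW with restr-cover n HW x (split-member sp sp₀ Xx refl)
... | v , Zx = x (level sp₀) ∷ v , Zx

OpenIn : SubSet → SubSet → Set
OpenIn Z X = ∃ λ K → ∀ x y → Z x → X y → AgreeBelow K x y → Z y

-- Every restriction X ↾ s is open in X: membership is decided by the bits at the levels used.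
restr-open : ∀ {n X Z} {s : Vec Bool n} → IsRestr X s Z → OpenIn Z X
restr-open {s = []} (lift Z≐X) = 0 , λ _ y _ Xy _ → proj₂ Z≐X y Xy
restr-open {s = b ∷ s} (_ , sp , r) with restr-open r
... | K , open-r = suc (level sp) ⊔ K , λ x y Zx Xy ag →
  open-r x y Zx
    (split-member sp sp Xy
      (trans (sym (agree-mono (m≤m⊔n (suc (level sp)) K) ag (level sp) (n<1+n (level sp))))
             (split-value sp sp (restr-sub r x Zx))))
    (agree-mono (m≤n⊔m (suc (level sp)) K) ag)

restr-disjoint : ∀ {n X} {u v : Vec Bool n} {Zu Zv} → IsRestr X u Zu → IsRestr X v Zv → u ≢ v →
  ∀ y → Zu y → Zv y → ⊥
restr-disjoint {u = []} {[]} _ _ u≢v = ⊥-elim (u≢v refl)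
restr-disjoint {u = b ∷ u} {c ∷ v} (_ , sp , r) (_ , sp' , r') bu≢cv y zu zv with b ≟B c
... | yes refl = restr-disjoint r (restr-resp (split-unique sp' sp) ≐-refl r')
                   (λ u≡v → bu≢cv (cong (b ∷_) u≡v)) y zu zv
... | no b≢c = b≢c (trans (sym (split-value sp sp (restr-sub r y zu)))
                          (split-value sp' sp (restr-sub r' y zv)))

tri-zero : ∀ {Y X} → Y ⊆ X → Tri 0 Y X
tri-zero Y⊆X [] Ys Xs (lift Ys≐Y) (lift Xs≐X) x ys = proj₂ Xs≐X x (Y⊆X x (proj₁ Ys≐Y x ys))

tri-≐ : ∀ {n Y X} → Y ≐ X → Tri n Y X
tri-≐ Y≐X s Ys Xs rY rX = proj₁ (restr-unique (restr-resp Y≐X ≐-refl rY) rX)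

tri-cons : ∀ {n Y X} (Yc Xc : Bool → SubSet) → (∀ c → IsSplit Y c (Yc c)) → (∀ c → IsSplit X c (Xc c)) →
  (∀ c → Tri n (Yc c) (Xc c)) → Tri (suc n) Y X
tri-cons Yc Xc spY spX tri (c ∷ v) Ys Xs (_ , sp₁ , r₁) (_ , sp₂ , r₂) =
  tri c v Ys Xs (restr-resp (split-unique sp₁ (spY c)) ≐-refl r₁)
                (restr-resp (split-unique sp₂ (spX c)) ≐-refl r₂)

glue-⊆ : ∀ {n X} {s₀ : Vec Bool n} {Z A} → (∀ u → IsRestr X u (Z u)) → A ⊆ Z s₀ →
  Glue A s₀ Z ⊆ X
glue-⊆ {s₀ = s₀} H A⊆Z x (inj₁ Ax) = restr-sub (H s₀) x (A⊆Z x Ax)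
glue-⊆ H A⊆Z x (inj₂ (u , _ , Zx)) = restr-sub (H u) x Zx

glue-nil : ∀ {Z A} → Glue A [] Z ≐ A
glue-nil = to , (λ x Ax → inj₁ Ax)
  where
  to : ∀ {Z A} x → Glue A [] Z x → A x
  to x (inj₁ Ax) = Ax
  to x (inj₂ ([] , []≢[] , _)) = ⊥-elim ([]≢[] refl)

glue-head : ∀ {n X b b' W} {t : Vec Bool n} {Z : Vec Bool (suc n) → SubSet} {A Y} →
  (∀ u → IsRestr X u (Z u)) → (sp : IsSplit X b' W) → A ⊆ Z (b ∷ t) → Y ≐ Glue A (b ∷ t) Z →
  (λ x → Y x × x (level sp) ≡ b) ≐ Glue A t (λ v → Z (b ∷ v))
glue-head {b = b} {t = t} {Z} {A} {Y} H sp A⊆Z (Y⊆G , G⊆Y) = to , from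
  where
  to : ∀ x → Y x × x (level sp) ≡ b → Glue A t (λ v → Z (b ∷ v)) x
  to x (Yx , xb) with Y⊆G x Yx
  ... | inj₁ Ax = inj₁ Ax
  ... | inj₂ (c ∷ v , cv≢bt , Zx) with trans (sym (restr-head-value sp (H (c ∷ v)) Zx)) xb
  ... | refl = inj₂ (v , (λ v≡t → cv≢bt (cong (c ∷_) v≡t)) , Zx)
  from : ∀ x → Glue A t (λ v → Z (b ∷ v)) x → Y x × x (level sp) ≡ b
  from x (inj₁ Ax) = G⊆Y x (inj₁ Ax) , restr-head-value sp (H (b ∷ t)) (A⊆Z x Ax)
  from x (inj₂ (v , v≢t , Zx)) =
    G⊆Y x (inj₂ (b ∷ v , (λ bv≡bt → v≢t (proj₂ (∷-injective bv≡bt))) , Zx)) ,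
    restr-head-value sp (H (b ∷ v)) Zx

glue-other : ∀ {n X b c b' W W'} {t : Vec Bool n} {Z : Vec Bool (suc n) → SubSet} {A Y} →
  (∀ u → IsRestr X u (Z u)) → (sp : IsSplit X c W) → (∀ v → IsRestr W v (Z (c ∷ v))) →
  (sp' : IsSplit X b' W') → c ≢ b → A ⊆ Z (b ∷ t) → Y ≐ Glue A (b ∷ t) Z →
  (λ x → Y x × x (level sp') ≡ c) ≐ W
glue-other {n} {c = c} {W = W} {Y = Y} H sp HW sp' c≢b A⊆Z (Y⊆G , G⊆Y) = to , from
  where
  to : ∀ x → Y x × x (level sp') ≡ c → W x
  to x (Yx , xc) = split-member sp sp' (glue-⊆ H A⊆Z x (Y⊆G x Yx)) xc
  from : ∀ x → W x → Y x × x (level sp') ≡ c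
  from x Wx with restr-cover n HW x Wx
  ... | v , Zx = G⊆Y x (inj₂ (c ∷ v , (λ cv≡bt → c≢b (proj₁ (∷-injective cv≡bt))) , Zx)) ,
                 split-value sp sp' Wx

glue-restr : ∀ n {X} {s₀ : Vec Bool n} {Z : Vec Bool n → SubSet} {A Y} →
  (∀ u → IsRestr X u (Z u)) → ∃ A → A ⊆ Z s₀ → Y ≐ Glue A s₀ Z →
  IsRestr Y s₀ A × Tri n Y X
glue-restr zero {s₀ = []} H _ A⊆Z Y≐G =
  lift (≐-sym (≐-trans Y≐G glue-nil)) , tri-zero (λ x Yx → glue-⊆ H A⊆Z x (proj₁ Y≐G x Yx))
glue-restr (suc n) {X} {b ∷ t} {Z} {A} {Y} H (a , Aa) A⊆Z Y≐G =
  (Y↾ b , splitY b , proj₁ IH) , tri-cons Y↾ W splitY splitX tri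
  where
  W : Bool → SubSet
  W c = proj₁ (head-split Z H c)
  splitX : ∀ c → IsSplit X c (W c)
  splitX c = proj₁ (proj₂ (head-split Z H c))
  m : ℕ
  m = level (splitX b)
  Y↾ : Bool → SubSet
  Y↾ c x = Y x × x m ≡ c
  Y⊆X : Y ⊆ X
  Y⊆X x Yx = glue-⊆ H A⊆Z x (proj₁ Y≐G x Yx)
  -- a witness on the other side of level m
  other : ∃ (Z (not b ∷ t))
  other = restr-nonempty (H (not b ∷ t)) (a , restr-sub (H (b ∷ t)) a (A⊆Z a Aa))
  splitY : ∀ c → IsSplit Y c (Y↾ c)
  splitY c = split-subset c (splitX b) Y⊆X
    (a , proj₁ other , proj₂ Y≐G a (inj₁ Aa) ,
     proj₂ Y≐G _ (inj₂ (not b ∷ t , (λ eq → not-¬ refl (sym (proj₁ (∷-injective eq)))) , proj₂ other)) ,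
     λ am≡om → not-¬ (restr-head-value (splitX b) (H (b ∷ t)) (A⊆Z a Aa))
                 (trans am≡om (restr-head-value (splitX b) (H (not b ∷ t)) (proj₂ other))))
  IH : IsRestr (Y↾ b) t A × Tri n (Y↾ b) (W b)
  IH = glue-restr n (proj₂ (proj₂ (head-split Z H b))) (a , Aa) A⊆Z (glue-head H (splitX b) A⊆Z Y≐G)
  tri : ∀ c → Tri n (Y↾ c) (W c)
  tri c with c ≟B b
  ... | yes refl = proj₂ IH
  ... | no c≢b = tri-≐ (glue-other H (splitX c) (proj₂ (proj₂ (head-split Z H c))) (splitX b) c≢b A⊆Z Y≐G)

Adherent : SubSet → Cantor → Set
Adherent X x = ∀ k → ∃ λ y → X y × AgreeBelow k x y

adherent-mono : ∀ {X X' x} → X ⊆ X' → Adherent X x → Adherent X' x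
adherent-mono X⊆X' adh k with adh k
... | y , Xy , ag = y , X⊆X' y Xy , ag

-- Near a point of Z s₀ the glued set is contained in A, since the pieces are open and disjoint;
-- hence a point of Z s₀ adherent to the glued set is adherent to A.
glue-adherent-A : ∀ {n X} {s₀ : Vec Bool n} {Z A x} → (∀ u → IsRestr X u (Z u)) → A ⊆ Z s₀ →
  Z s₀ x → Adherent (Glue A s₀ Z) x → Adherent A x
glue-adherent-A {s₀ = s₀} {Z} {A} {x} H A⊆Z Zx adh k with restr-open (H s₀)
... | K , open-s₀ with adh (k ⊔ K)
... | y , Gy , ag = y , near y Gy (agree-mono (m≤n⊔m k K) ag) , agree-mono (m≤m⊔n k K) ag
  where
  near : ∀ y → Glue A s₀ Z y → AgreeBelow K x y → A y
  near y (inj₁ Ay) _ = Ay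
  near y Gy@(inj₂ (u , u≢s₀ , Zuy)) ag' =
    ⊥-elim (restr-disjoint (H u) (H s₀) u≢s₀ y Zuy (open-s₀ x y Zx (glue-⊆ H A⊆Z y Gy) ag'))

-- The glued set is closed: an adherent point lies in X, hence in some piece Z u; for u ≠ s₀
-- that piece is part of the glued set, and for u = s₀ the point is adherent to A.
glue-closed : ∀ {n X} {s₀ : Vec Bool n} {Z A} → Closed X → (∀ u → IsRestr X u (Z u)) →
  Closed A → A ⊆ Z s₀ → Closed (Glue A s₀ Z)
glue-closed {n} {s₀ = s₀} clX H clA A⊆Z x adh
  with restr-cover n H x (clX x (adherent-mono (glue-⊆ H A⊆Z) adh))
... | u , Zux with ≡-dec _≟B_ u s₀
... | no u≢s₀ = inj₂ (u , u≢s₀ , Zux)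
... | yes refl = inj₁ (clA x (glue-adherent-A H A⊆Z Zux adh))

open-noIsolated : ∀ {Z X} → Z ⊆ X → OpenIn Z X → NoIsolated X → NoIsolated Z
open-noIsolated Z⊆X (K , open-Z) niX x Zx k with niX x (Z⊆X x Zx) (k ⊔ K)
... | y , Xy , ag , d = y , open-Z x y Zx Xy (agree-mono (m≤n⊔m k K) ag) , agree-mono (m≤m⊔n k K) ag , d

glue-noIsolated : ∀ {n} {s₀ : Vec Bool n} {Z A} → NoIsolated A → (∀ u → NoIsolated (Z u)) →
  NoIsolated (Glue A s₀ Z)
glue-noIsolated niA niZ x (inj₁ Ax) k with niA x Ax k
... | y , Ay , ag , d = y , inj₁ Ay , ag , d
glue-noIsolated niA niZ x (inj₂ (u , u≢s₀ , Zux)) k with niZ u x Zux k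
... | y , Zuy , ag , d = y , inj₂ (u , u≢s₀ , Zuy) , ag , d

lemma3p1 : (X : SubSet) (n : ℕ) (s₀ : Vec Bool n) (Z : Vec Bool n → SubSet) (A : SubSet) →
    Perfect X →
    (∀ u → IsRestr X u (Z u)) →
    Perfect A → A ⊆ Z s₀ →
    Perfect (Glue A s₀ Z) × Tri n (Glue A s₀ Z) X × IsRestr (Glue A s₀ Z) s₀ A
lemma3p1 X n s₀ Z A (_ , clX , niX) H ((a , Aa) , clA , niA) A⊆Z =
  perfect , proj₂ restriction , proj₁ restriction
  where
  restriction : IsRestr (Glue A s₀ Z) s₀ A × Tri n (Glue A s₀ Z) X
  restriction = glue-restr n H (a , Aa) A⊆Z ≐-refl
  pieces-noIsolated : ∀ u → NoIsolated (Z u)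
  pieces-noIsolated u = open-noIsolated (restr-sub (H u)) (restr-open (H u)) niX
  perfect : Perfect (Glue A s₀ Z)
  perfect = (a , inj₁ Aa) , glue-closed clX H clA A⊆Z , glue-noIsolated niA pieces-noIsolated
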